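{- Let $w$ be the infinite word over $\{1,2,3,4\}$ defined in the context. Then $w$ contains no factor $v$ with kernel period $q$ such that $$\frac{|v|}{q}\ \ge\ \frac{35}{34}+\frac{9}{2\cdot 1966}.$$
   Context: Let $A_4=\{1,2,3,4\}$. Let $f:A_4^*\to A_4^*$ be the morphism defined by $f(1)=121$, $f(2)=123$, $f(3)=141$, $f(4)=142$, and let $w=\lim_{k\to\infty} f^k(1)$ be the infinite fixed point of $f$ (beginning with $1$). For a word $v$ and letter $a$, $|v|_a$ denotes the number of occurrences of $a$ in $v$ and $|v|$ the length of $v$. Let $\ker\psi=\{v\in A_4^* : 4 \text{ divides } |v|_a \text{ for every } a\in A_4\}$. A word $v$ has period $q$ (a positive integer with $q\le |v|$) if $v_i=v_{i+q}$ for all valid indices $i$. We say $q$ is a kernel period of $v$ if $v$ has period $q$ and the prefix of $v$ of length $q$ belongs to $\ker\psi$. -}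

module Defs where

open import Data.Nat using (ℕ; zero; suc; _+_; _*_; _<_; _≤_)
open import Data.Nat.Divisibility using (_∣_)
open import Data.List using (List; []; _∷_; _++_; concatMap; length)
open import Data.Maybe using (Maybe; just; nothing)
open import Relation.Binary.PropositionalEquality using (_≡_)
open import Data.Bool using (Bool; true; false; if_then_else_)

data Letter : Set where
  l1 l2 l3 l4 : Letter

_≟L_ : Letter → Letter → Bool
l1 ≟L l1 = true
l2 ≟L l2 = true
l3 ≟L l3 = true
l4 ≟L l4 = true
_ ≟L _ = false

fL : Letter → List Letter
fL l1 = l1 ∷ l2 ∷ l1 ∷ []
fL l2 = l1 ∷ l2 ∷ l3 ∷ []
fL l3 = l1 ∷ l4 ∷ l1 ∷ []
fL l4 = l1 ∷ l4 ∷ l2 ∷ []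

f : List Letter → List Letter
f = concatMap fL

fPow : ℕ → List Letter
fPow zero    = l1 ∷ []
fPow (suc k) = f (fPow k)

-- total lookup (default l1 when out of range; never used for w, see below)
at : List Letter → ℕ → Letter
at []       _       = l1
at (x ∷ xs) zero    = x
at (x ∷ xs) (suc n) = at xs n

-- The infinite fixed point w = lim f^k(1), as a function ℕ → Letter (0-indexed).
-- Since f(1) begins with 1, f^k(1) is a prefix of f^(k+1)(1), and
-- |f^(n+1)(1)| = 3^(n+1) > n, so position n of w is position n of f^(n+1)(1).
w : ℕ → Letter
w n = at (fPow (suc n)) n

count : Letter → ℕ → ℕ → ℕ
count a i zero    = 0
count a i (suc m) = (if w i ≟L a then 1 else 0) + count a (suc i) m

InKer : ℕ → ℕ → Set
InKer i m = ∀ (a : Letter) → 4 ∣ count a i m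

HasPeriod : ℕ → ℕ → ℕ → Set
HasPeriod i L q = 1 ≤ q × q ≤ L × (∀ j → j + q < L → w (i + j) ≡ w (i + j + q))
  where open import Data.Product using (_×_)

KernelPeriod : ℕ → ℕ → ℕ → Set
KernelPeriod i L q = HasPeriod i L q × InKer i q
  where open import Data.Product using (_×_)

module Submission where

-- Write f(x) = 1 · second x · third x; the fixed point w then satisfies
-- w(3t) = 1, w(3t+1) = second (w t) and w(3t+2) = third (w t).  A factor
-- with kernel period q is w[i .. i+q+p), and the length hypothesis reads
-- 4238·q ≤ 133688·p.  We prove a stronger statement: there is no
-- "configuration", i.e. no such factor satisfying the weighted inequality
-- 234·4238·q ≤ 133688·(234·p + λ + ρ), where λ and ρ are credits of
-- states of two small automata describing the pairs of letters just
-- outside the periodic factor.  The proof is by strong induction on q.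
--  * Descent (p ≥ 3): three consecutive agreements force 3 ∣ q; the factor
--    then desubstitutes to one of period q/3 whose prefix is again in ker ψ
--    (the Parikh matrix of f is invertible modulo 4), the boundary states
--    evolve along the automata, and the weighted inequality is inherited.
--  * Base (p ≤ 2): q is a multiple of 4; q ≥ 104 violates the inequality,
--    and q ≤ 100 is excluded by evaluating all candidates inside the blocks
--    f⁵(w m · w (m+1)) = w[243m .. 243m+486), which cover w.
-- The file develops, in this order: the block structure of w; letter counts
-- and ker ψ; synchronisation; finite facts about letters and the boundary
-- automata; configurations and the descent; the exhaustive base case; the
-- theorem, with the plain factor as a configuration with open states.

open import Defs
open import Data.Nat using (ℕ; _*_; _≤_)
open import Relation.Nullary using (¬_)
open import Data.Product using (_×_)

open import Data.Nat
  using ( zero; suc; _+_; _∸_; _^_; pred; _<_; _≤′_; ≤′-refl; ≤′-step; z≤n; s≤s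
        ; _≤ᵇ_; _≡ᵇ_; _≤?_; _<?_ )
open import Data.Nat.Properties
open import Data.Nat.Divisibility
  using (_∣_; divides; ∣-trans; n∣m*n; m∣m*n; ∣m∣n⇒∣m+n; ∣m+n∣m⇒∣n; n∣m⇒m%n≡0)
open import Data.Nat.DivMod using (_%_; _/_; m≡m%n+[m/n]*n; m%n<n)
open import Data.Nat.Induction using (<-rec)
open import Data.Nat.Tactic.RingSolver using (solve-∀)
open import Data.Bool using (Bool; true; false; T; not; _∧_; _∨_; if_then_else_)
open import Data.Bool.Properties using (T-∧)
open import Data.Empty using (⊥; ⊥-elim)
open import Data.Fin using (Fin; toℕ)
open import Data.Fin.Patterns using (0F; 1F; 2F)
open import Data.Fin.Properties using (toℕ<n)
open import Data.List using (List; []; _∷_; _++_; length; drop; upTo)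
open import Data.List.Properties using (++-assoc; ++-identityʳ)
open import Data.List.Membership.Propositional using (_∈_)
open import Data.List.Membership.Propositional.Properties using (∈-upTo⁺)
open import Data.List.Relation.Unary.Any using (here; there)
open import Data.Maybe using (Maybe; just; nothing)
open import Data.Product using (Σ; ∃; ∃₂; _,_; proj₁; proj₂)
open import Data.Sum using (_⊎_; inj₁; inj₂)
open import Data.Unit using (tt)
open import Function.Bundles using (Equivalence)
open import Relation.Nullary using (yes; no; contradiction)
open import Relation.Binary.PropositionalEquality

second third : Letter → Letter
second l1 = l2
second l2 = l2
second l3 = l4
second l4 = l4
third l1 = l1
third l2 = l3
third l3 = l1
third l4 = l2

fL-shape : ∀ x → fL x ≡ l1 ∷ second x ∷ third x ∷ []
fL-shape l1 = refl
fL-shape l2 = refl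
fL-shape l3 = refl
fL-shape l4 = refl

f-∷ : ∀ x xs → f (x ∷ xs) ≡ l1 ∷ second x ∷ third x ∷ f xs
f-∷ x xs = cong (_++ f xs) (fL-shape x)

f-++ : ∀ xs ys → f (xs ++ ys) ≡ f xs ++ f ys
f-++ []       ys = refl
f-++ (x ∷ xs) ys rewrite f-∷ x (xs ++ ys) | f-∷ x xs | f-++ xs ys = refl

length-f : ∀ xs → length (f xs) ≡ length xs * 3
length-f []       = refl
length-f (x ∷ xs) rewrite f-∷ x xs | length-f xs = refl

at-++ : ∀ xs ys {n} → n < length xs → at (xs ++ ys) n ≡ at xs n
at-++ (x ∷ xs) ys {zero}  _         = refl
at-++ (x ∷ xs) ys {suc n} (s≤s n<) = at-++ xs ys n<

at-f-block : ∀ u t → t < length u →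
  at (f u) (t * 3) ≡ l1 × at (f u) (suc (t * 3)) ≡ second (at u t)
    × at (f u) (suc (suc (t * 3))) ≡ third (at u t)
at-f-block (x ∷ xs) zero    _        rewrite f-∷ x xs = refl , refl , refl
at-f-block (x ∷ xs) (suc t) (s≤s t<) rewrite f-∷ x xs = at-f-block xs t t<

image : Fin 3 → Letter → Letter
image 0F _ = l1
image 1F x = second x
image 2F x = third x

at-f : ∀ u r t → t < length u → at (f u) (toℕ r + t * 3) ≡ image r (at u t)
at-f u 0F t t<u = proj₁ (at-f-block u t t<u)
at-f u 1F t t<u = proj₁ (proj₂ (at-f-block u t t<u))
at-f u 2F t t<u = proj₂ (proj₂ (at-f-block u t t<u))

-- Since f(1) begins with 1, each f^k(1) is a prefix of f^(k+1)(1) ...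
fPow-step : ∀ k → ∃ λ r → fPow (suc k) ≡ fPow k ++ r
fPow-step zero = l2 ∷ l1 ∷ [] , refl
fPow-step (suc k) with fPow-step k
... | r , eq = f r , trans (cong f eq) (f-++ (fPow k) r)

fPow-prefix : ∀ {k k'} → k ≤′ k' → ∃ λ r → fPow k' ≡ fPow k ++ r
fPow-prefix {k} ≤′-refl = [] , sym (++-identityʳ (fPow k))
fPow-prefix {k} (≤′-step {k'} le) with fPow-prefix le | fPow-step k'
... | r , eq | s , eq' = r ++ s , (begin
  fPow (suc k')         ≡⟨ eq' ⟩
  fPow k' ++ s          ≡⟨ cong (_++ s) eq ⟩
  (fPow k ++ r) ++ s    ≡⟨ ++-assoc (fPow k) r s ⟩
  fPow k ++ (r ++ s)    ∎)
  where open ≡-Reasoning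

-- |f^k(1)| = 3^k > k, so position n of w is fixed from f^(n+1)(1) on.
k<length-fPow : ∀ k → k < length (fPow k)
k<length-fPow zero    = s≤s z≤n
k<length-fPow (suc k) rewrite length-f (fPow k) = triple (k<length-fPow k)
  where
  triple : ∀ {m L} → m < L → suc m < L * 3
  triple {L = suc L} m<L = ≤-<-trans m<L (m<m*n (suc L) 3 (s≤s (s≤s z≤n)))

n<length-fPow-suc : ∀ n → n < length (fPow (suc n))
n<length-fPow-suc n = <-trans (n<1+n n) (k<length-fPow (suc n))

w-fPow : ∀ k {n} → n < length (fPow k) → w n ≡ at (fPow k) n
w-fPow k {n} n< with ≤-total k (suc n)
... | inj₁ k≤ with fPow-prefix (≤⇒≤′ k≤)
...   | r , eq rewrite eq = at-++ (fPow k) r n<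
w-fPow k {n} n< | inj₂ ≤k with fPow-prefix (≤⇒≤′ ≤k)
...   | r , eq rewrite eq = sym (at-++ (fPow (suc n)) r (n<length-fPow-suc n))

-- The fixed-point equation w = f(w), letter by letter.
w-at : ∀ r t → w (toℕ r + t * 3) ≡ image r (w t)
w-at r t = begin
  w (toℕ r + t * 3)                      ≡⟨ w-fPow (suc (suc t)) inside ⟩
  at (f (fPow (suc t))) (toℕ r + t * 3)  ≡⟨ at-f (fPow (suc t)) r t (n<length-fPow-suc t) ⟩
  image r (at (fPow (suc t)) t)          ≡⟨ cong (image r) (sym (w-fPow (suc t) (n<length-fPow-suc t))) ⟩
  image r (w t)                          ∎
  where
  open ≡-Reasoning
  inside : toℕ r + t * 3 < length (f (fPow (suc t)))
  inside = subst (toℕ r + t * 3 <_) (sym (length-f (fPow (suc t))))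
             (≤-trans (+-monoˡ-< (t * 3) (toℕ<n r)) (*-monoˡ-≤ 3 (n<length-fPow-suc t)))

w-at-shift : ∀ r t s → w (toℕ r + t * 3 + s * 3) ≡ image r (w (t + s))
w-at-shift r t s = trans (cong w eq) (w-at r (t + s))
  where
  eq : toℕ r + t * 3 + s * 3 ≡ toℕ r + (t + s) * 3
  eq = trans (+-assoc (toℕ r) _ _) (cong (toℕ r +_) (sym (*-distribʳ-+ 3 t s)))

desubst-pair : ∀ (R : Letter → Letter → Set) r m s →
  R (w (toℕ r + m * 3)) (w (toℕ r + m * 3 + s * 3)) → R (image r (w m)) (image r (w (m + s)))
desubst-pair R r m s = subst₂ R (w-at r m) (w-at-shift r m s)

residue3 : ∀ n → ∃₂ λ (r : Fin 3) t → toℕ r + t * 3 ≡ n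
residue3 zero = 0F , 0 , refl
residue3 (suc n) with residue3 n
... | 0F , t , refl = 1F , t , refl
... | 1F , t , refl = 2F , t , refl
... | 2F , t , refl = 0F , suc t , refl

δ : Letter → Letter → ℕ
δ x a = if x ≟L a then 1 else 0

Σ4 : (Letter → ℕ) → ℕ
Σ4 g = g l1 + g l2 + g l3 + g l4

Σ4-cong : ∀ (g h : Letter → ℕ) → (∀ a → g a ≡ h a) → Σ4 g ≡ Σ4 h
Σ4-cong _ _ e = cong₂ _+_ (cong₂ _+_ (cong₂ _+_ (e l1) (e l2)) (e l3)) (e l4)

Σ4-+ : ∀ (g h : Letter → ℕ) → Σ4 (λ a → g a + h a) ≡ Σ4 g + Σ4 h
Σ4-+ g h = interchange (g l1) (g l2) (g l3) (g l4) (h l1) (h l2) (h l3) (h l4)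
  where
  interchange : ∀ a b c d a' b' c' d' →
    a + a' + (b + b') + (c + c') + (d + d') ≡ a + b + c + d + (a' + b' + c' + d')
  interchange = solve-∀

Σ4-linear : ∀ (m g h : Letter → ℕ) →
            Σ4 (λ a → m a * (g a + h a)) ≡ Σ4 (λ a → m a * g a) + Σ4 (λ a → m a * h a)
Σ4-linear m g h = trans (Σ4-cong _ (λ a → m a * g a + m a * h a) (λ a → *-distribˡ-+ (m a) (g a) (h a)))
                          (Σ4-+ (λ a → m a * g a) (λ a → m a * h a))

Σ4-point : ∀ (g : Letter → ℕ) x → Σ4 (λ a → g a * δ x a) ≡ g x
Σ4-point g l1 = pick (g l1) (g l2) (g l3) (g l4)
  where
  pick : ∀ a b c d → a * 1 + b * 0 + c * 0 + d * 0 ≡ a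
  pick = solve-∀
Σ4-point g l2 = pick (g l1) (g l2) (g l3) (g l4)
  where
  pick : ∀ a b c d → a * 0 + b * 1 + c * 0 + d * 0 ≡ b
  pick = solve-∀
Σ4-point g l3 = pick (g l1) (g l2) (g l3) (g l4)
  where
  pick : ∀ a b c d → a * 0 + b * 0 + c * 1 + d * 0 ≡ c
  pick = solve-∀
Σ4-point g l4 = pick (g l1) (g l2) (g l3) (g l4)
  where
  pick : ∀ a b c d → a * 0 + b * 0 + c * 0 + d * 1 ≡ d
  pick = solve-∀

Σ4-δ : ∀ x → Σ4 (δ x) ≡ 1
Σ4-δ l1 = refl
Σ4-δ l2 = refl
Σ4-δ l3 = refl
Σ4-δ l4 = refl

count-total : ∀ i q → Σ4 (λ a → count a i q) ≡ q
count-total i zero    = refl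
count-total i (suc q) =
  trans (Σ4-+ (δ (w i)) (λ a → count a (suc i) q)) (cong₂ _+_ (Σ4-δ (w i)) (count-total (suc i) q))

count-snoc : ∀ a j q → count a j (suc q) ≡ count a j q + δ (w (j + q)) a
count-snoc a j zero    = trans (+-identityʳ _) (cong (λ k → δ (w k) a) (sym (+-identityʳ j)))
count-snoc a j (suc q) = begin
  δ (w j) a + count a (suc j) (suc q)                    ≡⟨ cong (δ (w j) a +_) (count-snoc a (suc j) q) ⟩
  δ (w j) a + (count a (suc j) q + δ (w (suc j + q)) a)  ≡⟨ sym (+-assoc (δ (w j) a) _ _) ⟩
  δ (w j) a + count a (suc j) q + δ (w (suc j + q)) a    ≡⟨ cong (λ k → δ (w j) a + count a (suc j) q + δ (w k) a)
                                                                 (sym (+-suc j q)) ⟩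
  δ (w j) a + count a (suc j) q + δ (w (j + suc q)) a    ∎
  where open ≡-Reasoning

count-slide : ∀ a j q → w j ≡ w (j + q) → count a (suc j) q ≡ count a j q
count-slide a j q e = +-cancelˡ-≡ (δ (w j) a) _ _ (begin
  δ (w j) a + count a (suc j) q       ≡⟨ count-snoc a j q ⟩
  count a j q + δ (w (j + q)) a       ≡⟨ cong (λ x → count a j q + δ x a) (sym e) ⟩
  count a j q + δ (w j) a             ≡⟨ +-comm (count a j q) _ ⟩
  δ (w j) a + count a j q             ∎)
  where open ≡-Reasoning

Periodic : ℕ → ℕ → ℕ → Set
Periodic q lo hi = ∀ j → lo ≤ j → j < hi → w j ≡ w (j + q)

count-periodic : ∀ a {q lo hi j} → Periodic q lo hi → lo ≤′ j → j ≤ hi → count a j q ≡ count a lo q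
count-periodic a _ ≤′-refl _ = refl
count-periodic a {q} {lo} {j = suc j} per (≤′-step lo≤j) j<hi =
  trans (count-slide a j q (per j (≤′⇒≤ lo≤j) j<hi)) (count-periodic a per lo≤j (<⇒≤ j<hi))

fcount : Letter → Letter → ℕ
fcount a x = δ l1 a + (δ (second x) a + δ (third x) a)

count-block : ∀ a n m → count a (n * 3) (suc m * 3) ≡ fcount a (w n) + count a (suc n * 3) (m * 3)
count-block a n m rewrite w-at 0F n | w-at 1F n | w-at 2F n =
  sym (trans (+-assoc (δ l1 a) _ _) (cong (δ l1 a +_) (+-assoc (δ (second (w n)) a) _ _)))

M* : (Letter → ℕ) → Letter → ℕ
M* x a = Σ4 (λ b → fcount a b * x b)

count-f : ∀ a n m → count a (n * 3) (m * 3) ≡ M* (λ b → count b n m) a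
count-f a n zero    = sym (Σ4-cong (λ b → fcount a b * 0) (λ _ → 0) (λ b → *-zeroʳ (fcount a b)))
count-f a n (suc m) = begin
  count a (n * 3) (suc m * 3)                          ≡⟨ count-block a n m ⟩
  fcount a (w n) + count a (suc n * 3) (m * 3)         ≡⟨ cong₂ _+_ (sym (Σ4-point (fcount a) (w n)))
                                                                   (count-f a (suc n) m) ⟩
  M* (δ (w n)) a + M* (λ b → count b (suc n) m) a      ≡⟨ sym (Σ4-linear (fcount a) (δ (w n))
                                                                         (λ b → count b (suc n) m)) ⟩
  M* (λ b → count b n (suc m)) a                       ∎
  where open ≡-Reasoning

recover : ∀ (n y : Letter → ℕ) k {x} → (∀ a → 4 ∣ y a) → Σ4 (λ a → n a * y a) ≡ 4 * k + x → 4 ∣ x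
recover n y k 4∣y e = ∣m+n∣m⇒∣n (subst (4 ∣_) e Σ-divisible) (m∣m*n k)
  where
  term : ∀ a → 4 ∣ n a * y a
  term a = ∣-trans (4∣y a) (n∣m*n (n a))
  Σ-divisible : 4 ∣ Σ4 (λ a → n a * y a)
  Σ-divisible = ∣m∣n⇒∣m+n (∣m∣n⇒∣m+n (∣m∣n⇒∣m+n (term l1) (term l2)) (term l3)) (term l4)

-- The matrix M a b = |f(b)|_a, with rows (2,1,2,1), (1,1,0,1), (0,1,0,0),
-- (0,0,1,1), is invertible modulo 4: the rows (3,3,2,2), (0,0,1,0),
-- (3,2,3,3), (1,2,1,2) form an inverse.  Hence a vector whose image under
-- M is divisible by 4 is itself divisible by 4; each case is an identity
-- (row of the inverse) · M x = 4k + x b.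
M-invertible-mod4 : ∀ (x : Letter → ℕ) → (∀ a → 4 ∣ M* x a) → ∀ b → 4 ∣ x b
M-invertible-mod4 x h l1 = recover (λ { l1 → 3 ; l2 → 3 ; l3 → 2 ; l4 → 2 }) (M* x) (2 * Σ4 x) h
                                   (row (x l1) (x l2) (x l3) (x l4))
  where
  row : ∀ x1 x2 x3 x4 →
    3 * (2 * x1 + 1 * x2 + 2 * x3 + 1 * x4) + 3 * (1 * x1 + 1 * x2 + 0 * x3 + 1 * x4)
    + 2 * (0 * x1 + 1 * x2 + 0 * x3 + 0 * x4) + 2 * (0 * x1 + 0 * x2 + 1 * x3 + 1 * x4)
    ≡ 4 * (2 * (x1 + x2 + x3 + x4)) + x1
  row = solve-∀
M-invertible-mod4 x h l2 = recover (λ { l3 → 1 ; _ → 0 }) (M* x) 0 h (row (x l1) (x l2) (x l3) (x l4))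
  where
  row : ∀ x1 x2 x3 x4 →
    0 * (2 * x1 + 1 * x2 + 2 * x3 + 1 * x4) + 0 * (1 * x1 + 1 * x2 + 0 * x3 + 1 * x4)
    + 1 * (0 * x1 + 1 * x2 + 0 * x3 + 0 * x4) + 0 * (0 * x1 + 0 * x2 + 1 * x3 + 1 * x4)
    ≡ 4 * 0 + x2
  row = solve-∀
M-invertible-mod4 x h l3 = recover (λ { l2 → 2 ; _ → 3 }) (M* x) (2 * Σ4 x) h
                                   (row (x l1) (x l2) (x l3) (x l4))
  where
  row : ∀ x1 x2 x3 x4 →
    3 * (2 * x1 + 1 * x2 + 2 * x3 + 1 * x4) + 2 * (1 * x1 + 1 * x2 + 0 * x3 + 1 * x4)
    + 3 * (0 * x1 + 1 * x2 + 0 * x3 + 0 * x4) + 3 * (0 * x1 + 0 * x2 + 1 * x3 + 1 * x4)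
    ≡ 4 * (2 * (x1 + x2 + x3 + x4)) + x3
  row = solve-∀
M-invertible-mod4 x h l4 = recover (λ { l1 → 1 ; l2 → 2 ; l3 → 1 ; l4 → 2 }) (M* x) (Σ4 x) h
                                   (row (x l1) (x l2) (x l3) (x l4))
  where
  row : ∀ x1 x2 x3 x4 →
    1 * (2 * x1 + 1 * x2 + 2 * x3 + 1 * x4) + 2 * (1 * x1 + 1 * x2 + 0 * x3 + 1 * x4)
    + 1 * (0 * x1 + 1 * x2 + 0 * x3 + 0 * x4) + 2 * (0 * x1 + 0 * x2 + 1 * x3 + 1 * x4)
    ≡ 4 * (x1 + x2 + x3 + x4) + x4
  row = solve-∀

kernel-desubst : ∀ n m → InKer (n * 3) (m * 3) → InKer n m
kernel-desubst n m ker = M-invertible-mod4 (λ b → count b n m)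
                           (λ a → subst (4 ∣_) (count-f a n m) (ker a))

-- second never yields 1, so w has no 1 at positions ≡ 1 (mod 3).
second≢l1 : ∀ x → second x ≢ l1
second≢l1 l1 ()
second≢l1 l2 ()
second≢l1 l3 ()
second≢l1 l4 ()

window-has-0mod3 : ∀ j → ∃₂ λ d t → d < 3 × j + d ≡ t * 3
window-has-0mod3 j with residue3 j
... | 0F , t , refl = 0 , t , s≤s z≤n , +-identityʳ _
... | 1F , t , refl = 2 , suc t , s≤s (s≤s (s≤s z≤n)) , +-comm (suc (t * 3)) 2
... | 2F , t , refl = 1 , suc t , s≤s (s≤s z≤n) , +-comm (suc (suc (t * 3))) 1

window-has-1mod3 : ∀ j → ∃₂ λ d t → d < 3 × j + d ≡ suc (t * 3)
window-has-1mod3 j with residue3 j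
... | 0F , t , refl = 1 , t , s≤s (s≤s z≤n) , +-comm (t * 3) 1
... | 1F , t , refl = 0 , t , s≤s z≤n , +-identityʳ _
... | 2F , t , refl = 2 , suc t , s≤s (s≤s (s≤s z≤n)) , +-comm (suc (suc (t * 3))) 2

-- A shift q ≡ 1 (mod 3) moves some 1 of w onto a letter second(·) ≠ 1 ...
shift1-mismatch : ∀ t c → w (t * 3) ≢ w (t * 3 + suc (c * 3))
shift1-mismatch t c e = second≢l1 (w (t + c)) (sym (begin
  l1                           ≡⟨ sym (w-at 0F t) ⟩
  w (t * 3)                    ≡⟨ e ⟩
  w (t * 3 + suc (c * 3))      ≡⟨ cong w (position t c) ⟩
  w (suc ((t + c) * 3))        ≡⟨ w-at 1F (t + c) ⟩
  second (w (t + c))           ∎))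
  where
  open ≡-Reasoning
  position : ∀ t c → t * 3 + suc (c * 3) ≡ suc ((t + c) * 3)
  position = solve-∀

-- ... and a shift q ≡ 2 (mod 3) moves some letter second(·) onto a 1.
shift2-mismatch : ∀ t c → w (suc (t * 3)) ≢ w (suc (t * 3) + suc (suc (c * 3)))
shift2-mismatch t c e = second≢l1 (w t) (begin
  second (w t)                          ≡⟨ sym (w-at 1F t) ⟩
  w (suc (t * 3))                       ≡⟨ e ⟩
  w (suc (t * 3) + suc (suc (c * 3)))   ≡⟨ cong w (position t c) ⟩
  w (suc (t + c) * 3)                   ≡⟨ w-at 0F (suc (t + c)) ⟩
  l1                                    ∎)
  where
  open ≡-Reasoning
  position : ∀ t c → suc (t * 3) + suc (suc (c * 3)) ≡ suc (t + c) * 3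
  position = solve-∀

sync : ∀ j q → (∀ d → d < 3 → w (j + d) ≡ w (j + d + q)) → 3 ∣ q
sync j q agree with residue3 q
... | 0F , c , refl = divides c refl
... | 1F , c , refl with window-has-0mod3 j
...   | d , t , d<3 , eq =
  contradiction (subst (λ p → w p ≡ w (p + suc (c * 3))) eq (agree d d<3)) (shift1-mismatch t c)
sync j q agree | 2F , c , refl with window-has-1mod3 j
...   | d , t , d<3 , eq =
  contradiction (subst (λ p → w p ≡ w (p + suc (suc (c * 3)))) eq (agree d d<3)) (shift2-mismatch t c)

T-∧-split : ∀ a {b} → T (a ∧ b) → T a × T b
T-∧-split a = Equivalence.to (T-∧ {a})

both : ∀ {a b} → T a → T b → T (a ∧ b)
both p q = Equivalence.from T-∧ (p , q)

T-dichotomy : ∀ b → T b ⊎ T (not b)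
T-dichotomy true  = inj₁ tt
T-dichotomy false = inj₂ tt

≟L-sound : ∀ x y → T (x ≟L y) → x ≡ y
≟L-sound l1 l1 _ = refl
≟L-sound l2 l2 _ = refl
≟L-sound l3 l3 _ = refl
≟L-sound l4 l4 _ = refl

≟L-complete : ∀ {x y} → x ≡ y → T (x ≟L y)
≟L-complete {l1} refl = tt
≟L-complete {l2} refl = tt
≟L-complete {l3} refl = tt
≟L-complete {l4} refl = tt

every : ∀ {A : Set} → List A → (A → Bool) → Bool
every []       P = true
every (x ∷ xs) P = P x ∧ every xs P

every-sound : ∀ {A : Set} {xs : List A} {x} (P : A → Bool) → x ∈ xs → T (every xs P) → T (P x)
every-sound {xs = y ∷ ys} P (here refl) h = proj₁ (T-∧-split (P y) h)
every-sound {xs = y ∷ ys} P (there x∈) h = every-sound P x∈ (proj₂ (T-∧-split (P y) h))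

letters : List Letter
letters = l1 ∷ l2 ∷ l3 ∷ l4 ∷ []

every-letter : ∀ x → x ∈ letters
every-letter l1 = here refl
every-letter l2 = there (here refl)
every-letter l3 = there (there (here refl))
every-letter l4 = there (there (there (here refl)))

-- Facts about all 16 pairs of letters are checked by evaluation: the
-- type checker computes the Boolean and fills in the implicit argument.
pair-fact : ∀ (R : Letter → Letter → Bool) {_ : T (every letters (λ x → every letters (R x)))} →
           ∀ x y → T (R x y)
pair-fact R {h} x y = every-sound (R x) (every-letter y) (every-sound (λ x → every letters (R x)) (every-letter x) h)

implies : ∀ (P Q : Letter → Letter → Bool)
          {_ : T (every letters (λ x → every letters (λ y → not (P x y) ∨ Q x y)))} → ∀ x y → T (P x y) → T (Q x y)
implies P Q {h} x y p with P x y | pair-fact (λ x y → not (P x y) ∨ Q x y) {h} x y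
... | true | q = q

excludes : ∀ (P : Letter → Letter → Bool) {_ : T (every letters (λ x → every letters (λ y → not (P x y))))} →
           ∀ x y → ¬ T (P x y)
excludes P {h} x y p with P x y | pair-fact (λ x y → not (P x y)) {h} x y
... | true | ()

second-third-injective : ∀ x y → second x ≡ second y → third x ≡ third y → x ≡ y
second-third-injective x y e₂ e₃ = ≟L-sound x y
  (implies (λ x y → (second x ≟L second y) ∧ (third x ≟L third y)) _≟L_ x y
           (both (≟L-complete e₂) (≟L-complete e₃)))

-- A left state describes the pair (w(i−1), w(i−1+q))
-- just before a factor starting at i with period q, a right state the pair
-- (w e, w (e+q)) just after a factor ending before e.
data LeftSt : Set where
  L-open L-13 L-2 L-4 : LeftSt

data RightSt : Set where
  R-open R-12|34 R-34 : RightSt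

-- L-13: {x,y} = {1,3};  L-2: one letter is 2, the other 1 or 3;
-- L-4: exactly one letter is 4.
leftPair : LeftSt → Letter → Letter → Bool
leftPair L-open _  _  = true
leftPair L-13   l1 l3 = true
leftPair L-13   l3 l1 = true
leftPair L-2    l2 y  = not (y ≟L l2) ∧ not (y ≟L l4)
leftPair L-2    x  l2 = not (x ≟L l4)
leftPair L-4    l4 y  = not (y ≟L l4)
leftPair L-4    x  l4 = true
leftPair _      _  _  = false

rightPair : RightSt → Letter → Letter → Bool
rightPair R-open  _  _  = true
rightPair R-12|34 l1 l2 = true
rightPair R-12|34 l2 l1 = true
rightPair _       l3 l4 = true
rightPair _       l4 l3 = true
rightPair _       _  _  = false

-- A factor starting at 0 has no letter before it; only L-open applies.
LeftState : LeftSt → (i q : ℕ) → Set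
LeftState s zero     q = s ≡ L-open
LeftState s (suc i₀) q = T (leftPair s (w i₀) (w (i₀ + q)))

RightState : RightSt → (e q : ℕ) → Set
RightState s e q = T (rightPair s (w e) (w (e + q)))

L-open-holds : ∀ i q → LeftState L-open i q
L-open-holds zero    q = refl
L-open-holds (suc i) q = tt

-- Credits of the states, in units of 1/234 of a letter.  They are chosen
-- so that the credit inequalities of the boundary steps (LeftStep and
-- RightStep below) hold, which makes the weighted inequality hereditary.
creditL : LeftSt → ℕ
creditL L-open = 0
creditL L-13   = 81
creditL L-2    = 27
creditL L-4    = 9

creditR : RightSt → ℕ
creditR R-open  = 117
creditR R-12|34 = 195
creditR R-34    = 221

L-13-enter : ∀ x y → T (not (second x ≟L second y) ∧ (third x ≟L third y)) → T (leftPair L-13 x y)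
L-13-enter = implies (λ x y → not (second x ≟L second y) ∧ (third x ≟L third y)) (leftPair L-13)

L-13-second : ∀ x y → ¬ T (leftPair L-13 (second x) (second y))
L-13-second = excludes (λ x y → leftPair L-13 (second x) (second y))

L-13-third : ∀ x y → T (leftPair L-13 (third x) (third y)) → T (leftPair L-2 x y)
L-13-third = implies (λ x y → leftPair L-13 (third x) (third y)) (leftPair L-2)

L-2-second : ∀ x y → ¬ T (leftPair L-2 (second x) (second y))
L-2-second = excludes (λ x y → leftPair L-2 (second x) (second y))

L-2-third : ∀ x y → T (leftPair L-2 (third x) (third y)) → T (leftPair L-4 x y)
L-2-third = implies (λ x y → leftPair L-2 (third x) (third y)) (leftPair L-4)

L-4-second : ∀ x y → T (leftPair L-4 (second x) (second y)) → T (not (second x ≟L second y))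
L-4-second = implies (λ x y → leftPair L-4 (second x) (second y)) (λ x y → not (second x ≟L second y))

L-4-third : ∀ x y → ¬ T (leftPair L-4 (third x) (third y))
L-4-third = excludes (λ x y → leftPair L-4 (third x) (third y))

R-enter : ∀ x y → T (not (x ≟L y) ∧ (second x ≟L second y)) → T (rightPair R-12|34 x y)
R-enter = implies (λ x y → not (x ≟L y) ∧ (second x ≟L second y)) (rightPair R-12|34)

R-12|34-second : ∀ x y → ¬ T (rightPair R-12|34 (second x) (second y))
R-12|34-second = excludes (λ x y → rightPair R-12|34 (second x) (second y))

R-12|34-third : ∀ x y → T (rightPair R-12|34 (third x) (third y) ∧ (second x ≟L second y)) →
                T (rightPair R-34 x y)
R-12|34-third = implies (λ x y → rightPair R-12|34 (third x) (third y) ∧ (second x ≟L second y))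
                        (rightPair R-34)

R-34-second : ∀ x y → ¬ T (rightPair R-34 (second x) (second y))
R-34-second = excludes (λ x y → rightPair R-34 (second x) (second y))

R-34-third : ∀ x y → ¬ T (rightPair R-34 (third x) (third y))
R-34-third = excludes (λ x y → rightPair R-34 (third x) (third y))

periodic-∅ : ∀ {q} lo → Periodic q lo lo
periodic-∅ lo j lo≤j j<lo = ⊥-elim (<-irrefl refl (≤-<-trans lo≤j j<lo))

periodic-one : ∀ {q lo} → w lo ≡ w (lo + q) → Periodic q lo (suc lo)
periodic-one e j lo≤j (s≤s j≤lo) rewrite ≤-antisym j≤lo lo≤j = e

periodic-++ : ∀ {q lo mid hi} → Periodic q lo mid → Periodic q mid hi → Periodic q lo hi
periodic-++ {mid = mid} p₁ p₂ j lo≤j j<hi with j <? mid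
... | yes j<mid = p₁ j lo≤j j<mid
... | no  j≮mid = p₂ j (≮⇒≥ j≮mid) j<hi

agree-image : ∀ r m s → image r (w m) ≡ image r (w (m + s)) →
              w (toℕ r + m * 3) ≡ w (toℕ r + m * 3 + s * 3)
agree-image r m s e = trans (w-at r m) (trans e (sym (w-at-shift r m s)))

-- A credit inequality at positions k₁ + X and k₂ + X follows from the
-- closed instance X = 0, which is checked by evaluation.
lift234 : ∀ X k₁ k₂ c₁ c₂ {_ : T (k₁ * 234 + c₁ ≤ᵇ k₂ * 234 + c₂)} →
          (k₁ + X) * 234 + c₁ ≤ (k₂ + X) * 234 + c₂
lift234 X k₁ k₂ c₁ c₂ {h} = subst₂ _≤_ (reshape X k₁ c₁) (reshape X k₂ c₂)
                                    (+-monoʳ-≤ (X * 234) (≤ᵇ⇒≤ _ _ h))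
  where
  reshape : ∀ X k c → X * 234 + (k * 234 + c) ≡ (k + X) * 234 + c
  reshape = solve-∀

-- For a factor starting at i
-- with period 3q' we find its start a at the lower level (3a ≤ i+1) and a
-- new left state s'; the agreement extends leftwards to lo ≤ 3a, and the
-- credit inequality 234·3a + creditL s ≤ 234·i + 3·creditL s' holds.
record LeftStep (q' i : ℕ) (s : LeftSt) : Set where
  constructor leftStep
  field
    lo a     : ℕ
    s'       : LeftSt
    lo≤i     : lo ≤ i
    lo≤3a    : lo ≤ a * 3
    3a≤1+i   : a * 3 ≤ suc i
    periodic : Periodic (q' * 3) lo i
    state    : LeftState s' a q'
    credit   : a * 3 * 234 + creditL s ≤ i * 234 + creditL s' * 3

-- Open state: the agreement at i extends back to the start of its block;
-- only at offset 2 with different second letters is the block cut, and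
-- then the pair before the new start has type L-13.
desubst-left-open : ∀ q' i → w i ≡ w (i + q' * 3) → LeftStep q' i L-open
desubst-left-open q' i e with residue3 i
... | 0F , m , refl = leftStep (m * 3) m L-open ≤-refl ≤-refl (m≤n+m _ 1)
                        (periodic-∅ _) (L-open-holds m q') ≤-refl
... | 1F , m , refl = leftStep (m * 3) m L-open (m≤n+m _ 1) ≤-refl (m≤n+m _ 2)
                        (periodic-one (agree-image 0F m q' refl)) (L-open-holds m q') (lift234 (m * 3) 0 1 0 0)
... | 2F , m , refl with T-dichotomy (second (w m) ≟L second (w (m + q')))
...   | inj₁ same   = leftStep (m * 3) m L-open (m≤n+m _ 2) ≤-refl (m≤n+m _ 3)
                        (periodic-++ (periodic-one (agree-image 0F m q' refl))
                                     (periodic-one (agree-image 1F m q' (≟L-sound _ _ same))))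
                        (L-open-holds m q') (lift234 (m * 3) 0 2 0 0)
...   | inj₂ differ = leftStep (suc (suc (m * 3))) (suc m) L-13 ≤-refl (m≤n+m _ 1) ≤-refl
                        (periodic-∅ _)
                        (L-13-enter (w m) (w (m + q')) (both differ (≟L-complete (desubst-pair _≡_ 2F m q' e))))
                        (lift234 (m * 3) 3 2 0 243)

-- L-13 is only possible at offset 2, as the image of a pair of type L-2.
desubst-left-13 : ∀ q' i₀ → T (leftPair L-13 (w i₀) (w (i₀ + q' * 3))) → LeftStep q' (suc i₀) L-13
desubst-left-13 q' i₀ mem with residue3 i₀
... | 0F , m , refl = ⊥-elim (desubst-pair (λ x y → T (leftPair L-13 x y)) 0F m q' mem)
... | 1F , m , refl = ⊥-elim (L-13-second (w m) (w (m + q')) (desubst-pair (λ x y → T (leftPair L-13 x y)) 1F m q' mem))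
... | 2F , m , refl = leftStep (suc m * 3) (suc m) L-2 ≤-refl ≤-refl (n≤1+n _) (periodic-∅ _)
                        (L-13-third (w m) (w (m + q')) (desubst-pair (λ x y → T (leftPair L-13 x y)) 2F m q' mem)) ≤-refl

-- L-2 is only possible at offset 2, as the image of a pair of type L-4.
desubst-left-2 : ∀ q' i₀ → T (leftPair L-2 (w i₀) (w (i₀ + q' * 3))) → LeftStep q' (suc i₀) L-2
desubst-left-2 q' i₀ mem with residue3 i₀
... | 0F , m , refl = ⊥-elim (desubst-pair (λ x y → T (leftPair L-2 x y)) 0F m q' mem)
... | 1F , m , refl = ⊥-elim (L-2-second (w m) (w (m + q')) (desubst-pair (λ x y → T (leftPair L-2 x y)) 1F m q' mem))
... | 2F , m , refl = leftStep (suc m * 3) (suc m) L-4 ≤-refl ≤-refl (n≤1+n _) (periodic-∅ _)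
                        (L-2-third (w m) (w (m + q')) (desubst-pair (λ x y → T (leftPair L-2 x y)) 2F m q' mem)) ≤-refl

-- L-4 is only possible at offset 1; as the third letters then agree, the
-- underlying pair has type L-13.
desubst-left-4 : ∀ q' i₀ → T (leftPair L-4 (w i₀) (w (i₀ + q' * 3))) → w (suc i₀) ≡ w (suc i₀ + q' * 3) →
                LeftStep q' (suc i₀) L-4
desubst-left-4 q' i₀ mem e with residue3 i₀
... | 0F , m , refl = ⊥-elim (desubst-pair (λ x y → T (leftPair L-4 x y)) 0F m q' mem)
... | 2F , m , refl = ⊥-elim (L-4-third (w m) (w (m + q')) (desubst-pair (λ x y → T (leftPair L-4 x y)) 2F m q' mem))
... | 1F , m , refl = leftStep (suc (suc (m * 3))) (suc m) L-13 ≤-refl (m≤n+m _ 1) ≤-refl (periodic-∅ _)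
                        (L-13-enter (w m) (w (m + q'))
                          (both (L-4-second (w m) (w (m + q')) (desubst-pair (λ x y → T (leftPair L-4 x y)) 1F m q' mem))
                                (≟L-complete (desubst-pair _≡_ 2F m q' e))))
                        (lift234 (m * 3) 3 2 9 243)

-- At position 0 only the open state is possible.
desubst-left : ∀ q' i s → LeftState s i (q' * 3) → w i ≡ w (i + q' * 3) → LeftStep q' i s
desubst-left q' i        L-open _   e = desubst-left-open q' i e
desubst-left q' (suc i₀) L-13   mem _ = desubst-left-13 q' i₀ mem
desubst-left q' (suc i₀) L-2    mem _ = desubst-left-2 q' i₀ mem
desubst-left q' (suc i₀) L-4    mem e = desubst-left-4 q' i₀ mem e

-- For a factor with period 3q'
-- ending just before e (so it agrees with its shift at e − 1) we find its
-- end b at the lower level (e ≤ 3b+2) and a new right state s'; the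
-- agreement extends rightwards to hi ≥ 3b, and the credit inequality
-- 234·e + creditR s ≤ 234·3b + 3·creditR s' holds.
record RightStep (q' e : ℕ) (s : RightSt) : Set where
  constructor rightStep
  field
    hi b     : ℕ
    s'       : RightSt
    e≤hi     : e ≤ hi
    3b≤hi    : b * 3 ≤ hi
    e≤3b+2   : e ≤ suc (suc (b * 3))
    periodic : Periodic (q' * 3) e hi
    state    : RightState s' b q'
    credit   : e * 234 + creditR s ≤ b * 3 * 234 + creditR s' * 3

-- Open state: the agreement is cut at the end of the block of e; at offset
-- 2 with different letters, the underlying pair has equal second letters
-- (from the agreement at e − 1) and hence type R-12|34.
desubst-right-open : ∀ q' e → w (pred e) ≡ w (pred e + q' * 3) → RightStep q' e R-open
desubst-right-open q' e last with residue3 e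
... | 0F , m , refl = rightStep (m * 3) m R-open ≤-refl ≤-refl (m≤n+m _ 2) (periodic-∅ _) tt
                        (lift234 (m * 3) 0 0 117 351)
... | 1F , m , refl = rightStep (suc (m * 3)) m R-open ≤-refl (m≤n+m _ 1) (n≤1+n _) (periodic-∅ _) tt
                        (lift234 (m * 3) 1 0 117 351)
... | 2F , m , refl with T-dichotomy (w m ≟L w (m + q'))
...   | inj₁ same   = rightStep (suc m * 3) (suc m) R-open (n≤1+n _) ≤-refl (s≤s (s≤s (m≤n+m _ 3)))
                        (periodic-one (agree-image 2F m q' (cong third (≟L-sound _ _ same)))) tt
                        (lift234 (m * 3) 2 3 117 351)
...   | inj₂ differ = rightStep (suc (suc (m * 3))) m R-12|34 ≤-refl (m≤n+m _ 2) ≤-refl (periodic-∅ _)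
                        (R-enter (w m) (w (m + q')) (both differ (≟L-complete (desubst-pair _≡_ 1F m q' last))))
                        (lift234 (m * 3) 2 0 117 585)

-- R-12|34 is only possible at offset 2, as the image of a pair of type R-34.
desubst-right-12|34 : ∀ q' e → T (rightPair R-12|34 (w e) (w (e + q' * 3))) →
                     w (pred e) ≡ w (pred e + q' * 3) → RightStep q' e R-12|34
desubst-right-12|34 q' e mem last with residue3 e
... | 0F , m , refl = ⊥-elim (desubst-pair (λ x y → T (rightPair R-12|34 x y)) 0F m q' mem)
... | 1F , m , refl = ⊥-elim (R-12|34-second (w m) (w (m + q'))
                        (desubst-pair (λ x y → T (rightPair R-12|34 x y)) 1F m q' mem))
... | 2F , m , refl = rightStep (suc (suc (m * 3))) m R-34 ≤-refl (m≤n+m _ 2) ≤-refl (periodic-∅ _)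
                        (R-12|34-third (w m) (w (m + q'))
                          (both (desubst-pair (λ x y → T (rightPair R-12|34 x y)) 2F m q' mem)
                                (≟L-complete (desubst-pair _≡_ 1F m q' last))))
                        (lift234 (m * 3) 2 0 195 663)

-- 4 occurs only at positions ≡ 1 and 3 only at positions ≡ 2 (mod 3), so
-- a pair {3,4} never occurs at a distance divisible by 3.
desubst-right-34 : ∀ q' e → ¬ T (rightPair R-34 (w e) (w (e + q' * 3)))
desubst-right-34 q' e mem with residue3 e
... | 0F , m , refl = desubst-pair (λ x y → T (rightPair R-34 x y)) 0F m q' mem
... | 1F , m , refl = R-34-second (w m) (w (m + q')) (desubst-pair (λ x y → T (rightPair R-34 x y)) 1F m q' mem)
... | 2F , m , refl = R-34-third (w m) (w (m + q')) (desubst-pair (λ x y → T (rightPair R-34 x y)) 2F m q' mem)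

desubst-right : ∀ q' e s → RightState s e (q' * 3) → w (pred e) ≡ w (pred e + q' * 3) → RightStep q' e s
desubst-right q' e R-open  _   last = desubst-right-open q' e last
desubst-right q' e R-12|34 mem last = desubst-right-12|34 q' e mem last
desubst-right q' e R-34    mem _    = ⊥-elim (desubst-right-34 q' e mem)

-- The weighted length inequality, with credits c in units of 1/234:
-- (p + c/234) / q ≥ 4238 / 133688.
-- It is opaque so that the large constants are never unfolded.
opaque
  Heavy : (q p c : ℕ) → Set
  Heavy q p c = q * 991692 ≤ (p * 234 + c) * 133688

record Config (q : ℕ) : Set where
  constructor config
  field
    i p      : ℕ
    sL       : LeftSt
    sR       : RightSt
    q≥1      : 1 ≤ q
    periodic : Periodic q i (i + p)
    kernel   : InKer i q
    left     : LeftState sL i q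
    right    : RightState sR (i + p) q
    heavy    : Heavy q p (creditL sL + creditR sR)

heavy-desubst : ∀ {A B K} q' p p' a i l r l' r' →
  q' * 3 * A ≤ (p * K + (l + r)) * B →
  a * 3 * K + l ≤ i * K + l' * 3 →
  (i + p) * K + r ≤ (a + p') * 3 * K + r' * 3 →
  q' * A ≤ (p' * K + (l' + r')) * B
heavy-desubst {A} {B} {K} q' p p' a i l r l' r' heavy left right =
  *-cancelʳ-≤ (q' * A) ((p' * K + (l' + r')) * B) 3 (subst₂ _≤_ (reorder₁ q' A) (reorder₂ (p' * K + (l' + r')) B)
    (≤-trans heavy (*-monoˡ-≤ B excess)))
  where
  reorder₁ : ∀ q A → q * 3 * A ≡ q * A * 3
  reorder₁ = solve-∀
  reorder₂ : ∀ x B → x * 3 * B ≡ x * B * 3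
  reorder₂ = solve-∀
  lhs : ∀ a i p K l r → a * 3 * K + l + ((i + p) * K + r) ≡ (a * 3 * K + i * K) + (p * K + (l + r))
  lhs = solve-∀
  rhs : ∀ a i p' K l' r' → i * K + l' * 3 + ((a + p') * 3 * K + r' * 3) ≡ (a * 3 * K + i * K) + (p' * K + (l' + r')) * 3
  rhs = solve-∀
  excess : p * K + (l + r) ≤ (p' * K + (l' + r')) * 3
  excess = +-cancelˡ-≤ (a * 3 * K + i * K) _ _
             (subst₂ _≤_ (lhs a i p K l r) (rhs a i p' K l' r') (+-mono-≤ left right))

opaque
  unfolding Heavy
  heavy-inherited : ∀ q' p p' a i l r l' r' → Heavy (q' * 3) p (l + r) →
    a * 3 * 234 + l ≤ i * 234 + l' * 3 → (i + p) * 234 + r ≤ (a + p') * 3 * 234 + r' * 3 →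
    Heavy q' p' (l' + r')
  heavy-inherited = heavy-desubst

-- Agreement with the shift by 3s on [lo, hi) ⊇ [3a, 3b) descends, through
-- the second and third letters of the blocks, to agreement with the shift
-- by s on [a, b).
periodic-desubst : ∀ {s lo hi a b} → Periodic (s * 3) lo hi → lo ≤ a * 3 → b * 3 ≤ hi → Periodic s a b
periodic-desubst {s} {lo} {hi} per lo≤3a 3b≤hi n a≤n n<b = second-third-injective (w n) (w (n + s))
  (desubst-pair _≡_ 1F n s (per (suc (n * 3)) (≤-trans lo≤3n (n≤1+n _)) (<-trans (n<1+n _) block<hi)))
  (desubst-pair _≡_ 2F n s (per (suc (suc (n * 3))) (≤-trans lo≤3n (m≤n+m _ 2)) block<hi))
  where
  lo≤3n : lo ≤ n * 3
  lo≤3n = ≤-trans lo≤3a (*-monoˡ-≤ 3 a≤n)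
  block<hi : suc (suc (n * 3)) < hi
  block<hi = ≤-trans (*-monoˡ-≤ 3 n<b) 3b≤hi

kernel-move : ∀ {q lo hi j j'} → Periodic q lo hi → lo ≤ j → j ≤ hi → lo ≤ j' → j' ≤ hi →
              InKer j q → InKer j' q
kernel-move per lo≤j j≤hi lo≤j' j'≤hi ker a =
  subst (4 ∣_) (trans (count-periodic a per (≤⇒≤′ lo≤j) j≤hi)
                      (sym (count-periodic a per (≤⇒≤′ lo≤j') j'≤hi))) (ker a)

start≤end : ∀ {a b i p} → a * 3 ≤ suc i → i + p ≤ suc (suc (b * 3)) → 3 ≤ p → a ≤ b
start≤end {a} {b} {i} {p} 3a≤1+i e≤3b+2 3≤p = *-cancelʳ-≤ a b 3 (≤-trans 3a≤1+i (≤-pred (≤-pred (begin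
  suc (suc (suc i))   ≡⟨ +-comm 3 i ⟩
  i + 3               ≤⟨ +-monoʳ-≤ i 3≤p ⟩
  i + p               ≤⟨ e≤3b+2 ⟩
  suc (suc (b * 3))   ∎))))
  where open ≤-Reasoning

last-position : ∀ i p → 1 ≤ p → i ≤ pred (i + p) × pred (i + p) < i + p
last-position i (suc p₀) _ rewrite +-suc i p₀ = m≤m+n i p₀ , n<1+n _

desubst-config : ∀ q' → 1 ≤ q' → (c : Config (q' * 3)) → 3 ≤ Config.p c → Config q'
desubst-config q' q'≥1 (config i p sL sR _ per ker left right heavy) 3≤p =
  config L.a p' L.s' R.s' q'≥1 periodic' kernel' L.state right' heavy'
  where
  1≤p : 1 ≤ p
  1≤p = ≤-trans (s≤s z≤n) 3≤p
  module L = LeftStep (desubst-left q' i sL left (per i ≤-refl (m<m+n i 1≤p)))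
  lastAgrees : w (pred (i + p)) ≡ w (pred (i + p) + q' * 3)
  lastAgrees = per _ (proj₁ (last-position i p 1≤p)) (proj₂ (last-position i p 1≤p))
  module R = RightStep (desubst-right q' (i + p) sR right lastAgrees)
  per₃ : Periodic (q' * 3) L.lo R.hi
  per₃ = periodic-++ L.periodic (periodic-++ per R.periodic)
  a≤b : L.a ≤ R.b
  a≤b = start≤end L.3a≤1+i R.e≤3b+2 3≤p
  p' : ℕ
  p' = R.b ∸ L.a
  a+p'≡b : L.a + p' ≡ R.b
  a+p'≡b = m+[n∸m]≡n a≤b
  i≤hi : i ≤ R.hi
  i≤hi = ≤-trans (m≤m+n i p) R.e≤hi
  3a≤hi : L.a * 3 ≤ R.hi
  3a≤hi = ≤-trans (*-monoˡ-≤ 3 a≤b) R.3b≤hi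
  periodic' : Periodic q' L.a (L.a + p')
  periodic' = periodic-desubst per₃ L.lo≤3a (subst (λ b → b * 3 ≤ R.hi) (sym a+p'≡b) R.3b≤hi)
  kernel' : InKer L.a q'
  kernel' = kernel-desubst L.a q' (kernel-move per₃ L.lo≤i i≤hi L.lo≤3a 3a≤hi ker)
  right' : RightState R.s' (L.a + p') q'
  right' = subst (λ b → RightState R.s' b q') (sym a+p'≡b) R.state
  heavy' : Heavy q' p' (creditL L.s' + creditR R.s')
  heavy' = heavy-inherited q' p p' L.a i (creditL sL) (creditR sR) (creditL L.s') (creditR R.s') heavy L.credit
             (subst (λ b → (i + p) * 234 + creditR sR ≤ b * 3 * 234 + creditR R.s' * 3) (sym a+p'≡b) R.credit)

descent : ∀ {q} (c : Config q) → 3 ≤ Config.p c → Σ ℕ λ q' → q' < q × Config q'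
descent {q} c 3≤p with sync (Config.i c) q agreeOnFirstThree
  where
  agreeOnFirstThree : ∀ d → d < 3 → w (Config.i c + d) ≡ w (Config.i c + d + q)
  agreeOnFirstThree d d<3 = Config.periodic c _ (m≤m+n _ d) (+-monoʳ-< (Config.i c) (<-≤-trans d<3 3≤p))
... | divides zero refl = ⊥-elim (<-irrefl refl (Config.q≥1 c))
... | divides (suc k) refl = suc k , q'<q , desubst-config (suc k) (s≤s z≤n) c 3≤p
  where
  q'<q : suc k < suc k * 3
  q'<q = m<m*n (suc k) 3 (s≤s (s≤s z≤n))

iterF : ℕ → List Letter → List Letter
iterF zero    u = u
iterF (suc k) u = f (iterF k u)

length-iterF : ∀ k u → length (iterF k u) ≡ length u * 3 ^ k
length-iterF zero    u = sym (*-identityʳ (length u))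
length-iterF (suc k) u = begin
  length (f (iterF k u))      ≡⟨ length-f (iterF k u) ⟩
  length (iterF k u) * 3      ≡⟨ cong (_* 3) (length-iterF k u) ⟩
  length u * 3 ^ k * 3        ≡⟨ reorder (length u) (3 ^ k) ⟩
  length u * 3 ^ suc k        ∎
  where
  open ≡-Reasoning
  reorder : ∀ n y → n * y * 3 ≡ n * (3 * y)
  reorder = solve-∀

Occurs : ℕ → List Letter → Set
Occurs N u = ∀ j → j < length u → w (N + j) ≡ at u j

occurs-pair : ∀ m → Occurs m (w m ∷ w (suc m) ∷ [])
occurs-pair m zero          _ = cong w (+-identityʳ m)
occurs-pair m (suc zero)    _ = cong w (+-comm m 1)
occurs-pair m (suc (suc j)) (s≤s (s≤s ()))

occurs-f : ∀ N u → Occurs N u → Occurs (N * 3) (f u)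
occurs-f N u occ j j< with residue3 j
... | r , t , refl = begin
  w (N * 3 + (toℕ r + t * 3))     ≡⟨ cong w (reorder N (toℕ r) t) ⟩
  w (toℕ r + (N + t) * 3)         ≡⟨ w-at r (N + t) ⟩
  image r (w (N + t))             ≡⟨ cong (image r) (occ t t<u) ⟩
  image r (at u t)                ≡⟨ sym (at-f u r t t<u) ⟩
  at (f u) (toℕ r + t * 3)        ∎
  where
  open ≡-Reasoning
  reorder : ∀ N r t → N * 3 + (r + t * 3) ≡ r + (N + t) * 3
  reorder = solve-∀
  t<u : t < length u
  t<u = *-cancelʳ-< _ t (length u) (≤-trans (s≤s (m≤n+m (t * 3) (toℕ r))) (subst (j <_) (length-f u) j<))

occurs-iterF : ∀ k N u → Occurs N u → Occurs (N * 3 ^ k) (iterF k u)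
occurs-iterF zero    N u occ = subst (λ M → Occurs M u) (sym (*-identityʳ N)) occ
occurs-iterF (suc k) N u occ = subst (λ M → Occurs M (iterF (suc k) u)) (reorder N (3 ^ k))
                                 (occurs-f (N * 3 ^ k) (iterF k u) (occurs-iterF k N u occ))
  where
  reorder : ∀ N y → N * y * 3 ≡ N * (3 * y)
  reorder = solve-∀

-- w[243m .. 243m + 486) = f⁵(w m · w (m+1)).  Opaque, so that the closed
-- term block 0 is never evaluated during type checking.
opaque
  block : ℕ → List Letter
  block m = iterF 5 (w m ∷ w (suc m) ∷ [])

opaque
  unfolding block

  occurs-block : ∀ m → Occurs (m * 243) (block m)
  occurs-block m = occurs-iterF 5 m _ (occurs-pair m)

  length-block : ∀ m → length (block m) ≡ 486
  length-block m = length-iterF 5 (w m ∷ w (suc m) ∷ [])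

at-drop : ∀ u t j → at (drop t u) j ≡ at u (t + j)
at-drop []      zero    j       = refl
at-drop []      (suc t) zero    = refl
at-drop []      (suc t) (suc j) = refl
at-drop (x ∷ u) zero    j       = refl
at-drop (x ∷ u) (suc t) j       = at-drop u t j

drop-∷ : ∀ u t → t < length u → drop t u ≡ at u t ∷ drop (suc t) u
drop-∷ (x ∷ u) zero    _       = refl
drop-∷ (x ∷ u) (suc t) (s≤s t<) = drop-∷ u t t<

window-at : ∀ {N u} t j → Occurs N u → t + j < length u → w (N + t + j) ≡ at (drop t u) j
window-at {N} {u} t j occ t+j< =
  trans (cong w (+-assoc N t j)) (trans (occ (t + j) t+j<) (sym (at-drop u t j)))

countIn : Letter → ℕ → List Letter → ℕ
countIn a zero    _        = 0
countIn a (suc q) []       = 0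
countIn a (suc q) (x ∷ xs) = δ x a + countIn a q xs

countIn-window : ∀ a {N u} q t → Occurs N u → t + q ≤ length u → countIn a q (drop t u) ≡ count a (N + t) q
countIn-window a         zero    t occ _      = refl
countIn-window a {N} {u} (suc q) t occ t+q<u = begin
  countIn a (suc q) (drop t u)                         ≡⟨ cong (countIn a (suc q)) (drop-∷ u t t<u) ⟩
  δ (at u t) a + countIn a q (drop (suc t) u)         ≡⟨ cong₂ _+_ (cong (λ x → δ x a) (sym (occ t t<u)))
                                                            (countIn-window a {N} {u} q (suc t) occ t+q<u') ⟩
  δ (w (N + t)) a + count a (N + suc t) q              ≡⟨ cong (λ j → δ (w (N + t)) a + count a j q) (+-suc N t) ⟩
  count a (N + t) (suc q)                              ∎
  where
  open ≡-Reasoning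
  t+q<u' : suc t + q ≤ length u
  t+q<u' = subst (_≤ length u) (+-suc t q) t+q<u
  t<u : t < length u
  t<u = ≤-trans (s≤s (m≤m+n t q)) t+q<u'

kernelᵇ : List Letter → ℕ → Bool
kernelᵇ xs q = every letters (λ a → countIn a q xs % 4 ≡ᵇ 0)

periodicᵇ : List Letter → (q p : ℕ) → Bool
periodicᵇ xs q zero    = true
periodicᵇ xs q (suc p) = periodicᵇ xs q p ∧ (at xs p ≟L at xs (p + q))

isOpen : LeftSt → Bool
isOpen L-open = true
isOpen _      = false

leftᵇ : LeftSt → Maybe Letter → Letter → Bool
leftᵇ s nothing  _ = isOpen s
leftᵇ s (just x) y = leftPair s x y

heavyᵇ : (q p c : ℕ) → Bool
heavyᵇ q p c = q * 991692 ≤ᵇ (p * 234 + c) * 133688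

leftStates : List LeftSt
leftStates = L-open ∷ L-13 ∷ L-2 ∷ L-4 ∷ []

rightStates : List RightSt
rightStates = R-open ∷ R-12|34 ∷ R-34 ∷ []

safeᵇ : Maybe Letter → List Letter → ℕ → Bool
safeᵇ prev xs q = not (kernelᵇ xs q) ∨ every (upTo 3) λ p → not (periodicᵇ xs q p) ∨
  every leftStates λ sL → every rightStates λ sR →
    not (leftᵇ sL prev (at xs (q ∸ 1)) ∧ rightPair sR (at xs p) (at xs (p + q))
         ∧ heavyᵇ q p (creditL sL + creditR sR))

before : List Letter → ℕ → Maybe Letter
before u zero    = nothing
before u (suc t) = just (at u t)

blockSafeᵇ : List Letter → Bool
blockSafeᵇ u = every (upTo 244) λ t → every (upTo 25) λ k → safeᵇ (before u t) (drop t u) (suc k * 4)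

all-blocks-safe : ∀ x y → T (blockSafeᵇ (iterF 5 (x ∷ y ∷ [])))
all-blocks-safe = pair-fact (λ x y → blockSafeᵇ (iterF 5 (x ∷ y ∷ [])))

modus-ponens : ∀ a {b} → T (not a ∨ b) → T a → T b
modus-ponens true h _ = h

refute : ∀ a → T (not a) → ¬ T a
refute true () _

every-intro : ∀ {A : Set} (xs : List A) (P : A → Bool) → (∀ {x} → x ∈ xs → T (P x)) → T (every xs P)
every-intro []       P h = tt
every-intro (x ∷ xs) P h = both (h (here refl)) (every-intro xs P (λ x∈ → h (there x∈)))

every-leftSt : ∀ s → s ∈ leftStates
every-leftSt L-open = here refl
every-leftSt L-13   = there (here refl)
every-leftSt L-2    = there (there (here refl))
every-leftSt L-4    = there (there (there (here refl)))

every-rightSt : ∀ s → s ∈ rightStates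
every-rightSt R-open  = here refl
every-rightSt R-12|34 = there (here refl)
every-rightSt R-34    = there (there (here refl))

periodicᵇ-intro : ∀ xs q p → (∀ j → j < p → at xs j ≡ at xs (j + q)) → T (periodicᵇ xs q p)
periodicᵇ-intro xs q zero    _   = tt
periodicᵇ-intro xs q (suc p) agr = both (periodicᵇ-intro xs q p (λ j j<p → agr j (≤-trans j<p (n≤1+n p))))
                                        (≟L-complete (agr p ≤-refl))

safeᵇ-sound : ∀ prev xs q p sL sR → T (safeᵇ prev xs q) → T (kernelᵇ xs q) → p < 3 → T (periodicᵇ xs q p) →
  T (leftᵇ sL prev (at xs (q ∸ 1))) → T (rightPair sR (at xs p) (at xs (p + q))) →
  T (heavyᵇ q p (creditL sL + creditR sR)) → ⊥
safeᵇ-sound prev xs q p sL sR safe ker p<3 per left right heavy =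
  refute (leftOk sL ∧ rightOk sR) (every-sound (λ sR → not (leftOk sL ∧ rightOk sR)) (every-rightSt sR) sL-safe)
         (both left (both right heavy))
  where
  leftOk : LeftSt → Bool
  leftOk sL = leftᵇ sL prev (at xs (q ∸ 1))
  rightOk : RightSt → Bool
  rightOk sR = rightPair sR (at xs p) (at xs (p + q)) ∧ heavyᵇ q p (creditL sL + creditR sR)
  statesSafe : ℕ → LeftSt → Bool
  statesSafe p sL = every rightStates λ sR →
    not (leftᵇ sL prev (at xs (q ∸ 1)) ∧ rightPair sR (at xs p) (at xs (p + q)) ∧ heavyᵇ q p (creditL sL + creditR sR))
  excessSafe : ℕ → Bool
  excessSafe p = not (periodicᵇ xs q p) ∨ every leftStates (statesSafe p)
  sL-safe : T (statesSafe p sL)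
  sL-safe = every-sound (statesSafe p) (every-leftSt sL)
              (modus-ponens (periodicᵇ xs q p)
                (every-sound excessSafe (∈-upTo⁺ p<3) (modus-ponens (kernelᵇ xs q) safe ker)) per)

opaque
  unfolding Heavy
  heavy⇒heavyᵇ : ∀ {q p c} → Heavy q p c → T (heavyᵇ q p c)
  heavy⇒heavyᵇ = ≤⇒≤ᵇ

config-in-block : ∀ {q} (c : Config q) → Config.p c < 3 → ∀ {N u} t → Occurs N u →
  Config.i c ≡ N + t → t + (Config.p c + q) < length u →
  T (leftᵇ (Config.sL c) (before u t) (at (drop t u) (q ∸ 1))) → ¬ T (safeᵇ (before u t) (drop t u) q)
config-in-block {q} (config i p sL sR _ per ker _ right heavy) p<3 {N} {u} t occ refl bound left safe =
  safeᵇ-sound (before u t) (drop t u) q p sL sR safe kernel p<3 periodic left rightPairᵇ (heavy⇒heavyᵇ heavy)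
  where
  read : ∀ j → j ≤ p + q → w (N + t + j) ≡ at (drop t u) j
  read j j≤ = window-at {N} {u} t j occ (≤-<-trans (+-monoʳ-≤ t j≤) bound)
  kernel : T (kernelᵇ (drop t u) q)
  kernel = every-intro letters _ λ {a} _ → ≡⇒≡ᵇ _ 0 (trans (cong (_% 4) (countIn-window a {N} {u} q t occ window))
                                                         (n∣m⇒m%n≡0 _ 4 (ker a)))
    where
    window : t + q ≤ length u
    window = ≤-trans (+-monoʳ-≤ t (m≤n+m q p)) (<⇒≤ bound)
  periodic : T (periodicᵇ (drop t u) q p)
  periodic = periodicᵇ-intro _ q p λ j j<p → begin
    at (drop t u) j          ≡⟨ sym (read j (≤-trans (<⇒≤ j<p) (m≤m+n p q))) ⟩
    w (N + t + j)            ≡⟨ per (N + t + j) (m≤m+n _ j) (+-monoʳ-< (N + t) j<p) ⟩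
    w (N + t + j + q)        ≡⟨ cong w (+-assoc (N + t) j q) ⟩
    w (N + t + (j + q))      ≡⟨ read (j + q) (+-monoˡ-≤ q (<⇒≤ j<p)) ⟩
    at (drop t u) (j + q)    ∎
    where open ≡-Reasoning
  rightPairᵇ : T (rightPair sR (at (drop t u) p) (at (drop t u) (p + q)))
  rightPairᵇ = subst₂ (λ x y → T (rightPair sR x y)) (read p (m≤m+n p q))
                 (trans (cong w (+-assoc (N + t) p q)) (read (p + q) ≤-refl)) right

-- The letter counts of a window in ker ψ add up to its length, so 4 ∣ q.
period-multiple-of-4 : ∀ {i q} → InKer i q → 4 ∣ q
period-multiple-of-4 {i} {q} ker =
  subst (4 ∣_) (count-total i q) (∣m∣n⇒∣m+n (∣m∣n⇒∣m+n (∣m∣n⇒∣m+n (ker l1) (ker l2)) (ker l3)) (ker l4))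

creditL≤81 : ∀ s → creditL s ≤ 81
creditL≤81 s = ≤ᵇ⇒≤ (creditL s) 81 (pick s)
  where
  pick : ∀ s → T (creditL s ≤ᵇ 81)
  pick L-open = tt
  pick L-13   = tt
  pick L-2    = tt
  pick L-4    = tt

creditR≤221 : ∀ s → creditR s ≤ 221
creditR≤221 s = ≤ᵇ⇒≤ (creditR s) 221 (pick s)
  where
  pick : ∀ s → T (creditR s ≤ᵇ 221)
  pick R-open  = tt
  pick R-12|34 = tt
  pick R-34    = tt

-- With p ≤ 2 and credits at most 81 + 221, a period q ≥ 104 is too long to
-- be heavy: 104 · 991692 > (2 · 234 + 302) · 133688.
opaque
  unfolding Heavy
  too-long : ∀ q p c → p ≤ 2 → c ≤ 302 → 104 ≤ q → ¬ Heavy q p c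
  too-long q p c p≤2 c≤302 104≤q heavy = ≤⇒≤ᵇ (begin
    104 * 991692                 ≤⟨ *-monoˡ-≤ 991692 104≤q ⟩
    q * 991692                   ≤⟨ heavy ⟩
    (p * 234 + c) * 133688       ≤⟨ *-monoˡ-≤ 133688 (+-mono-≤ (*-monoˡ-≤ 234 p≤2) c≤302) ⟩
    (2 * 234 + 302) * 133688     ∎)
    where open ≤-Reasoning

block-position : ∀ i₀ → ∃₂ λ m s → s < 243 × i₀ ≡ m * 243 + s
block-position i₀ = i₀ / 243 , i₀ % 243 , m%n<n i₀ 243 , trans (m≡m%n+[m/n]*n i₀ 243) (+-comm (i₀ % 243) _)

safe-at : ∀ u t k → T (blockSafeᵇ u) → t < 244 → k < 25 → T (safeᵇ (before u t) (drop t u) (suc k * 4))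
safe-at u t k safe t<244 k<25 =
  every-sound (λ k → safeᵇ (before u t) (drop t u) (suc k * 4)) (∈-upTo⁺ k<25)
    (every-sound (λ t → every (upTo 25) λ k → safeᵇ (before u t) (drop t u) (suc k * 4)) (∈-upTo⁺ t<244) safe)

opaque
  unfolding block
  safe-in-block : ∀ m t k → t < 244 → k < 25 → T (safeᵇ (before (block m) t) (drop t (block m)) (suc k * 4))
  safe-in-block m t k = safe-at (block m) t k (all-blocks-safe (w m) (w (suc m)))

in-block : ∀ {t p k} m → t ≤ 243 → p < 3 → k < 25 → t + (p + suc k * 4) < length (block m)
in-block m t≤243 p<3 k<25 = subst (_ <_) (sym (length-block m))
  (≤-<-trans (+-mono-≤ t≤243 (+-mono-≤ (≤-pred p<3) (*-monoˡ-≤ 4 k<25))) (≤ᵇ⇒≤ 346 486 tt))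

left-in-block : ∀ {N u} s q₀ sL → Occurs N u → suc s + q₀ < length u →
  T (leftPair sL (w (N + s)) (w (N + s + suc q₀))) → T (leftᵇ sL (before u (suc s)) (at (drop (suc s) u) q₀))
left-in-block {N} {u} s q₀ sL occ bound = subst₂ (λ x y → T (leftPair sL x y)) (occ s s<u) (begin
  w (N + s + suc q₀)          ≡⟨ cong w (+-suc (N + s) q₀) ⟩
  w (suc (N + s) + q₀)        ≡⟨ cong (λ j → w (j + q₀)) (sym (+-suc N s)) ⟩
  w (N + suc s + q₀)          ≡⟨ window-at {N} {u} (suc s) q₀ occ bound ⟩
  at (drop (suc s) u) q₀      ∎)
  where
  open ≡-Reasoning
  s<u : s < length u
  s<u = ≤-trans (s≤s (m≤m+n s q₀)) (<⇒≤ bound)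

-- Short excess, p ≤ 2, with q = 4(k+1) ≤ 100: the configuration lies in a
-- block f⁵(w m · w (m+1)) starting at 243m, which was checked exhaustively.
base-small : ∀ k (c : Config (suc k * 4)) → Config.p c < 3 → k < 25 → ⊥
base-small k c@(config zero p sL sR _ _ _ left _ _) p<3 k<25 =
  config-in-block c p<3 {0 * 243} {block 0} 0 (occurs-block 0) refl (in-block 0 z≤n p<3 k<25)
    (subst (λ s → T (isOpen s)) (sym left) tt) (safe-in-block 0 0 k (s≤s z≤n) k<25)
base-small k c@(config (suc i₀) p sL sR _ _ _ left _ _) p<3 k<25 with block-position i₀
... | m , s , s<243 , refl =
  config-in-block c p<3 {m * 243} {block m} (suc s) (occurs-block m) (sym (+-suc (m * 243) s)) bound
    (left-in-block {m * 243} {block m} s (q ∸ 1) sL (occurs-block m) left-bound left)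
    (safe-in-block m (suc s) k (s≤s s<243) k<25)
  where
  q : ℕ
  q = suc k * 4
  bound : suc s + (p + q) < length (block m)
  bound = in-block m s<243 p<3 k<25
  left-bound : suc s + (q ∸ 1) < length (block m)
  left-bound = ≤-<-trans (+-monoʳ-≤ (suc s) (≤-trans (m∸n≤m q 1) (m≤n+m q p))) bound

base : ∀ {q} (c : Config q) → Config.p c ≤ 2 → ⊥
base {q} c p≤2 with period-multiple-of-4 {Config.i c} {q} (Config.kernel c)
... | divides zero refl = <-irrefl refl (Config.q≥1 c)
... | divides (suc k) refl with k <? 25
...   | yes k<25 = base-small k c (s≤s p≤2) k<25
...   | no  k≮25 = too-long _ (Config.p c) _ p≤2 credits≤ (*-monoˡ-≤ 4 (s≤s (≮⇒≥ k≮25))) (Config.heavy c)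
  where
  credits≤ : creditL (Config.sL c) + creditR (Config.sR c) ≤ 302
  credits≤ = +-mono-≤ (creditL≤81 (Config.sL c)) (creditR≤221 (Config.sR c))

no-config : ∀ q → ¬ Config q
no-config = <-rec (λ q → ¬ Config q) step
  where
  step : ∀ q → (∀ {q'} → q' < q → ¬ Config q') → ¬ Config q
  step q smaller c with 3 ≤? Config.p c
  ... | yes 3≤p = let q' , q'<q , c' = descent c 3≤p in smaller q'<q c'
  ... | no  3≰p = base c (≤-pred (≰⇒> 3≰p))

opaque
  unfolding Heavy
  initial-heavy : ∀ q p → 137926 * q ≤ 133688 * (q + p) → Heavy q p 117
  initial-heavy q p long = begin
    q * 991692              ≡⟨ scale q ⟩
    234 * (4238 * q)        ≤⟨ *-monoʳ-≤ 234 excess ⟩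
    234 * (133688 * p)      ≡⟨ reorder p ⟩
    p * 234 * 133688        ≤⟨ *-monoˡ-≤ 133688 (m≤m+n (p * 234) 117) ⟩
    (p * 234 + 117) * 133688 ∎
    where
    open ≤-Reasoning
    scale : ∀ q → q * 991692 ≡ 234 * (4238 * q)
    scale = solve-∀
    reorder : ∀ p → 234 * (133688 * p) ≡ p * 234 * 133688
    reorder = solve-∀
    split : ∀ q → 137926 * q ≡ 133688 * q + 4238 * q
    split = solve-∀
    excess : 4238 * q ≤ 133688 * p
    excess = +-cancelˡ-≤ (133688 * q) _ _
               (subst₂ _≤_ (split q) (*-distribˡ-+ 133688 q p) long)

-- A factor w[i .. i+L) with kernel period q and L/q ≥ 137926/133688, i.e.
-- |v|/q ≥ 35/34 + 9/(2·1966), would be a configuration with open states.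
mainTheorem2 : ∀ (i L q : ℕ) → ¬ (KernelPeriod i L q × 137926 * q ≤ 133688 * L)
mainTheorem2 i L q (((q≥1 , q≤L , period) , ker) , long) =
  no-config q (config i p L-open R-open q≥1 periodic ker (L-open-holds i q) tt
                 (initial-heavy q p (subst (λ n → 137926 * q ≤ 133688 * n) (sym q+p≡L) long)))
  where
  p : ℕ
  p = L ∸ q
  q+p≡L : q + p ≡ L
  q+p≡L = m+[n∸m]≡n q≤L
  periodic : Periodic q i (i + p)
  periodic j i≤j j<i+p with m≤n⇒∃[o]m+o≡n i≤j
  ... | d , refl = period d (subst (d + q <_) (trans (+-comm p q) q+p≡L) (+-monoˡ-< q (+-cancelˡ-< i d p j<i+p)))
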